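{- Let $k\geq 2$ be an integer and let $(b_1,\dots,b_k)$ be a $k$-tuple of natural numbers. For $x\geq 3$ put \[ g_k(x):=\frac{x}{\log x}-k\,\frac{4e\,(432)^2}{\log 4}. \] Let $M=M(k)$ be the smallest integer $M\geq 5$ such that $g_k(M-2)>0$. If $b_i\geq M$ for every $1\leq i\leq k$, then there are infinitely many natural numbers $N$ such that, for every $i\in\{1,\dots,k\}$, $N$ can be written in base $b_i$ without the digit $0$.
   Context: A natural number $N$ can be written in base $b$ without the digit $0$ if there is $j\in\mathbb{N}_0$ such that $N=\sum_{0\leq i\leq j}c_i b^i$ with all $c_i\in\{1,\dots,b-1\}$. Here $\log$ is the natural logarithm. -}

module Defs where

open import Data.Nat using (ℕ; zero; suc; _+_; _*_; _∸_; _^_; _≤_; _<_; _!)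

open import Data.List using (List; []; _∷_)
open import Data.List.Relation.Unary.All using (All)
open import Data.Product using (Σ; ∃; _×_)
open import Data.Fin using (Fin)
open import Relation.Nullary using (¬_)
open import Relation.Binary.PropositionalEquality using (_≡_; _≢_)

evalBase : ℕ → List ℕ → ℕ
evalBase b []       = 0
evalBase b (c ∷ cs) = c + b * evalBase b cs

ZeroFreeIn : ℕ → ℕ → Set
ZeroFreeIn b N =
  Σ (List ℕ) λ cs → (cs ≢ []) × All (λ c → 1 ≤ c × c < b) cs × (N ≡ evalBase b cs)

-- S n = Σ_{i=0}^{n} n!/i!, so that s_n = Σ_{i≤n} 1/i! = S n / n!
S : ℕ → ℕ
S zero    = 1
S (suc n) = suc n * S n + 1

-- e < a / b  (b > 0), witnessed by the standard upper bound
-- e < s_n + 1/(n·n!) , i.e. (n·S n + 1)/(n·n!) < a/b.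
-- Since these upper bounds decrease to e, this is equivalent to e < a/b.
ELess : ℕ → ℕ → Set
ELess a b = ∃ λ n → 1 ≤ n × b * (n * S n + 1) < a * (n * (n !))

-- g_k(x) = x/log x − k·4e·432²/log 4 > 0   (for x ≥ 3)
-- ⇔ 4^x > x^(4e·432²·k)
-- ⇔ ∃ rational p/q > 4e·432²·k with 4^(x q) > x^p.
GPos : ℕ → ℕ → Set
GPos k x = Σ ℕ λ p → Σ ℕ λ q →
  1 ≤ q × ELess p (q * (4 * (432 ^ 2) * k)) × x ^ p < 4 ^ (x * q)

IsM : ℕ → ℕ → Set
IsM k M = 5 ≤ M × GPos k (M ∸ 2) × (∀ M′ → 5 ≤ M′ → M′ < M → ¬ GPos k (M′ ∸ 2))

InfinitelyMany : (ℕ → Set) → Set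
InfinitelyMany P = ∀ n → ∃ λ N → n < N × P N

{-# OPTIONS --safe #-}
module Submission where

-- Put T = M, so that every b_i ≥ T, and descend
-- through the T-adic blocks [A, A + T ^ m) of [0, T ^ (n + 1)), keeping at level m a block in which
-- no b_i has a zero digit at a place b_i ^ j ≥ T ^ m.  The zero digits at the places just below T ^ m
-- are controlled by a potential, their number in the block weighted by 4 to the number of levels
-- above the place, which is kept at most T ^ m / 8.  Among the T sub-blocks of a block of level m + 1
-- few contain a zero digit at a place in [T ^ m, T ^ (m + 1)): such a digit persists along T ^ m
-- consecutive integers and is already counted by the potential of the block, so at most 3/8 of the
-- sub-blocks are spoilt.  Descending a level divides the old weights by 4 and adds the places
-- entering the potential, which are rare since b_i ≥ 160 k; averaging over the unspoilt sub-blocks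
-- gives one whose potential is again at most T ^ m / 8.  Level 0 yields an N ≥ T ^ n without zero
-- digits in any base b_i.

open import Defs
open import Data.Fin using (Fin; toℕ; fromℕ<)
open import Data.Fin.Properties using (toℕ<n; fromℕ<-toℕ)

open import Data.Nat
open import Data.Nat.Properties
open import Data.Nat.DivMod
open import Data.Product using (∃; _×_; _,_; proj₁; proj₂)
open import Data.Empty using (⊥; ⊥-elim)
open import Relation.Nullary using (¬_; Dec; yes; no)
open import Relation.Nullary.Decidable using (_×-dec_; ¬?)
open import Relation.Binary.PropositionalEquality
open import Data.Nat.Induction using (<-rec)
open import Data.List using ([]; _∷_)
open import Data.List.Relation.Unary.All using ([]; _∷_)
open import Data.Nat.Tactic.RingSolver

sum : ℕ → (ℕ → ℕ) → ℕ
sum zero    g = 0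
sum (suc n) g = sum n g + g n

syntax sum n (λ t → e) = ∑[ t < n ] e

𝟙[_] : {P : Set} → Dec P → ℕ
𝟙[ yes _ ] = 1
𝟙[ no _ ]  = 0

module _ {P : Set} where

  𝟙≤1 : (d : Dec P) → 𝟙[ d ] ≤ 1
  𝟙≤1 (yes _) = ≤-refl
  𝟙≤1 (no _)  = z≤n

  𝟙-yes : (d : Dec P) → P → 𝟙[ d ] ≡ 1
  𝟙-yes (yes _) _ = refl
  𝟙-yes (no ¬p) p = ⊥-elim (¬p p)

  𝟙-no : (d : Dec P) → ¬ P → 𝟙[ d ] ≡ 0
  𝟙-no (yes p) ¬p = ⊥-elim (¬p p)
  𝟙-no (no _)  _  = refl

𝟙*𝟙≡0 : {P Q : Set} (p? : Dec P) (q? : Dec Q) → (P → ¬ Q) → 𝟙[ p? ] * 𝟙[ q? ] ≡ 0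
𝟙*𝟙≡0 (yes p) (yes q) excl = ⊥-elim (excl p q)
𝟙*𝟙≡0 (yes p) (no _)  excl = refl
𝟙*𝟙≡0 (no _)  q?      excl = refl

𝟙-mono : {P Q : Set} → (P → Q) → (d : Dec P) (e : Dec Q) → 𝟙[ d ] ≤ 𝟙[ e ]
𝟙-mono f (yes p) e = ≤-reflexive (sym (𝟙-yes e (f p)))
𝟙-mono f (no _)  e = z≤n

sum-cong : ∀ n {g h} → (∀ t → t < n → g t ≡ h t) → sum n g ≡ sum n h
sum-cong zero    _  = refl
sum-cong (suc n) eq = cong₂ _+_ (sum-cong n (λ t t<n → eq t (m<n⇒m<1+n t<n))) (eq n ≤-refl)

sum-mono-≤ : ∀ n {g h} → (∀ t → t < n → g t ≤ h t) → sum n g ≤ sum n h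
sum-mono-≤ zero    _  = z≤n
sum-mono-≤ (suc n) le = +-mono-≤ (sum-mono-≤ n (λ t t<n → le t (m<n⇒m<1+n t<n))) (le n ≤-refl)

sum-const : ∀ n c → ∑[ _ < n ] c ≡ n * c
sum-const zero    c = refl
sum-const (suc n) c = trans (cong (_+ c) (sum-const n c)) (+-comm (n * c) c)

sum-zero : ∀ n → ∑[ _ < n ] 0 ≡ 0
sum-zero n = trans (sum-const n 0) (*-zeroʳ n)

sum-≤-* : ∀ n {g} c → (∀ t → t < n → g t ≤ c) → sum n g ≤ n * c
sum-≤-* n c le = subst (_ ≤_) (sum-const n c) (sum-mono-≤ n le)

sum-+ : ∀ n g h → ∑[ t < n ] (g t + h t) ≡ sum n g + sum n h
sum-+ zero    g h = refl
sum-+ (suc n) g h = begin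
  ∑[ t < n ] (g t + h t) + (g n + h n) ≡⟨ cong (_+ (g n + h n)) (sum-+ n g h) ⟩
  sum n g + sum n h + (g n + h n)      ≡⟨ +-assoc-swap (sum n g) (sum n h) (g n) (h n) ⟩
  sum n g + g n + (sum n h + h n)      ∎
  where
  open ≡-Reasoning
  +-assoc-swap : ∀ a b c d → a + b + (c + d) ≡ a + c + (b + d)
  +-assoc-swap = solve-∀

sum-*ˡ : ∀ n c g → ∑[ t < n ] (c * g t) ≡ c * sum n g
sum-*ˡ zero    c g = sym (*-zeroʳ c)
sum-*ˡ (suc n) c g = trans (cong (_+ c * g n) (sum-*ˡ n c g)) (sym (*-distribˡ-+ c (sum n g) (g n)))

sum-*ʳ : ∀ n c g → ∑[ t < n ] (g t * c) ≡ sum n g * c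
sum-*ʳ n c g = trans (sum-cong n (λ t _ → *-comm (g t) c)) (trans (sum-*ˡ n c g) (*-comm c _))

sum-swap : ∀ n m (g : ℕ → ℕ → ℕ) → ∑[ x < n ] (∑[ y < m ] g x y) ≡ ∑[ y < m ] (∑[ x < n ] g x y)
sum-swap zero    m g = sym (sum-zero m)
sum-swap (suc n) m g = trans (cong (_+ ∑[ y < m ] g n y) (sum-swap n m g))
                             (sym (sum-+ m (λ y → ∑[ x < n ] g x y) (g n)))

sum-++ : ∀ a b g → sum (a + b) g ≡ sum a g + ∑[ t < b ] g (a + t)
sum-++ a zero    g = trans (cong (λ x → sum x g) (+-identityʳ a)) (sym (+-identityʳ _))
sum-++ a (suc b) g = begin
  sum (a + suc b) g                              ≡⟨ cong (λ x → sum x g) (+-suc a b) ⟩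
  sum (a + b) g + g (a + b)                      ≡⟨ cong (_+ g (a + b)) (sum-++ a b g) ⟩
  sum a g + ∑[ t < b ] g (a + t) + g (a + b)     ≡⟨ +-assoc (sum a g) _ _ ⟩
  sum a g + (∑[ t < b ] g (a + t) + g (a + b))   ∎
  where open ≡-Reasoning

sum-blocks : ∀ T L g → sum (T * L) g ≡ ∑[ c < T ] (∑[ t < L ] g (c * L + t))
sum-blocks zero    L g = refl
sum-blocks (suc T) L g = begin
  sum (L + T * L) g                           ≡⟨ cong (λ x → sum x g) (+-comm L (T * L)) ⟩
  sum (T * L + L) g                           ≡⟨ sum-++ (T * L) L g ⟩
  sum (T * L) g + ∑[ t < L ] g (T * L + t)    ≡⟨ cong (_+ ∑[ t < L ] g (T * L + t)) (sum-blocks T L g) ⟩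
  _                                           ∎
  where open ≡-Reasoning

sum-shift-≤ : ∀ g r n M → r + n ≤ M → ∑[ t < n ] g (r + t) ≤ sum M g
sum-shift-≤ g r n M le = begin
  ∑[ t < n ] g (r + t)                      ≤⟨ m≤n+m _ _ ⟩
  sum r g + ∑[ t < n ] g (r + t)            ≡⟨ sum-++ r n g ⟨
  sum (r + n) g                             ≤⟨ m≤m+n _ _ ⟩
  sum (r + n) g + ∑[ t < e ] g (r + n + t)  ≡⟨ sum-++ (r + n) e g ⟨
  sum (r + n + e) g                         ≡⟨ cong (λ x → sum x g) (m+[n∸m]≡n le) ⟩
  sum M g                                   ∎
  where
  open ≤-Reasoning
  e = M ∸ (r + n)

sum-window-≤ : ∀ g {W a} n M → W ≤ a → a + n ≤ W + M → ∑[ t < n ] g (a + t) ≤ ∑[ t < M ] g (W + t)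
sum-window-≤ g {W} {a} n M W≤a a+n≤W+M = begin
  ∑[ t < n ] g (a + t)               ≡⟨ sum-cong n (λ t _ → cong g (+-assoc-≤ W≤a t)) ⟨
  ∑[ t < n ] g (W + (a ∸ W + t))     ≤⟨ sum-shift-≤ (λ t → g (W + t)) (a ∸ W) n M fits ⟩
  ∑[ t < M ] g (W + t)               ∎
  where
  open ≤-Reasoning
  +-assoc-≤ : W ≤ a → ∀ t → W + (a ∸ W + t) ≡ a + t
  +-assoc-≤ W≤a t = trans (sym (+-assoc W (a ∸ W) t)) (cong (_+ t) (m+[n∸m]≡n W≤a))
  fits : a ∸ W + n ≤ M
  fits = +-cancelˡ-≤ W _ _ (subst (_≤ W + M) (sym (+-assoc-≤ W≤a n)) a+n≤W+M)

term≤sum : ∀ n g t → t < n → g t ≤ sum n g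
term≤sum n g t t<n =
  subst (λ x → g x ≤ sum n g) (+-identityʳ t) (sum-shift-≤ g t 1 n (subst (_≤ n) (+-comm 1 t) t<n))

sum≡0⇒ : ∀ n g → sum n g ≡ 0 → ∀ t → t < n → g t ≡ 0
sum≡0⇒ n g z t t<n = n≤0⇒n≡0 (subst (g t ≤_) z (term≤sum n g t t<n))

sum>0⇒ : ∀ n g → 0 < sum n g → ∃ λ t → t < n × 0 < g t
sum>0⇒ (suc n) g p with g n in eq
... | suc _ = n , ≤-refl , subst (0 <_) (sym eq) z<s
... | zero with sum>0⇒ n g (subst (0 <_) (+-identityʳ _) p)
...   | t , t<n , gt = t , m<n⇒m<1+n t<n , gt

sum-windows-≤ : ∀ n L M g → 2 + n ≤ M → ∑[ d < n ] (∑[ v < 3 * L ] g (d * L + v)) ≤ 3 * sum (M * L) g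
sum-windows-≤ n L M g 2+n≤M = begin
  ∑[ d < n ] (∑[ v < 3 * L ] g (d * L + v))                    ≡⟨ sum-cong n (λ d _ → three-blocks d) ⟩
  ∑[ d < n ] (G d + G (1 + d) + G (2 + d))                     ≡⟨ sum-+ n _ _ ⟩
  ∑[ d < n ] (G d + G (1 + d)) + ∑[ d < n ] G (2 + d)          ≡⟨ cong (_+ ∑[ d < n ] G (2 + d)) (sum-+ n _ _) ⟩
  ∑[ d < n ] G d + ∑[ d < n ] G (1 + d) + ∑[ d < n ] G (2 + d) ≤⟨ +-mono-≤ (+-mono-≤ (shifted 0 (≤-trans (n≤1+n _) (n≤1+n _)))
                                                                                    (shifted 1 (n≤1+n _)))
                                                                          (shifted 2 ≤-refl) ⟩
  sum M G + sum M G + sum M G                                  ≡⟨ triple (sum M G) ⟩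
  3 * sum M G                                                  ≡⟨ cong (3 *_) (sum-blocks M L g) ⟨
  3 * sum (M * L) g                                            ∎
  where
  open ≤-Reasoning
  G : ℕ → ℕ
  G c = ∑[ v < L ] g (c * L + v)
  triple : ∀ x → x + x + x ≡ 3 * x
  triple = solve-∀
  shifted : ∀ r → r + n ≤ 2 + n → ∑[ d < n ] G (r + d) ≤ sum M G
  shifted r le = sum-shift-≤ G r n M (≤-trans le 2+n≤M)
  three-blocks : ∀ d → ∑[ v < 3 * L ] g (d * L + v) ≡ G d + G (1 + d) + G (2 + d)
  three-blocks d = begin-equality
    sum (L + (L + (L + 0))) h                                  ≡⟨ sum-++ L (L + (L + 0)) h ⟩
    sum L h + ∑[ t < L + (L + 0) ] h (L + t)                   ≡⟨ cong (sum L h +_) (sum-++ L (L + 0) _) ⟩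
    sum L h + (∑[ t < L ] h (L + t) + ∑[ t < L + 0 ] h (L + (L + t)))
                                                               ≡⟨ cong (λ x → sum L h + (∑[ t < L ] h (L + t) + ∑[ t < x ] h (L + (L + t))))
                                                                       (+-identityʳ L) ⟩
    sum L h + (∑[ t < L ] h (L + t) + ∑[ t < L ] h (L + (L + t)))
                                                               ≡⟨ +-assoc (sum L h) _ _ ⟨
    sum L h + ∑[ t < L ] h (L + t) + ∑[ t < L ] h (L + (L + t))
                                                               ≡⟨ cong₂ (λ x y → sum L h + x + y)
                                                                        (sum-cong L (λ t _ → cong g (one-block d L t)))
                                                                        (sum-cong L (λ t _ → cong g (two-blocks d L t))) ⟩
    G d + G (1 + d) + G (2 + d)                                ∎
    where
    h : ℕ → ℕ
    h v = g (d * L + v)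
    one-block : ∀ d L t → d * L + (L + t) ≡ (1 + d) * L + t
    one-block = solve-∀
    two-blocks : ∀ d L t → d * L + (L + (L + t)) ≡ (2 + d) * L + t
    two-blocks = solve-∀

sum-rotate : ∀ n h → ∑[ t < n ] h (suc t) + h 0 ≡ sum n h + h n
sum-rotate zero    h = refl
sum-rotate (suc n) h = begin
  ∑[ t < n ] h (suc t) + h (suc n) + h 0  ≡⟨ +-swapʳ (∑[ t < n ] h (suc t)) (h (suc n)) (h 0) ⟩
  ∑[ t < n ] h (suc t) + h 0 + h (suc n)  ≡⟨ cong (_+ h (suc n)) (sum-rotate n h) ⟩
  sum n h + h n + h (suc n)               ∎
  where
  open ≡-Reasoning
  +-swapʳ : ∀ a b c → a + b + c ≡ a + c + b
  +-swapʳ = solve-∀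

sum-𝟙-unique-≤ : ∀ n {P : ℕ → Set} (P? : ∀ j → Dec (P j)) (g : ℕ → ℕ) X →
                 (∀ j j′ → P j → P j′ → j ≡ j′) → (∀ j → P j → g j ≤ X) →
                 ∑[ j < n ] (𝟙[ P? j ] * g j) ≤ X
sum-𝟙-unique-≤ zero    P? g X unique bound = z≤n
sum-𝟙-unique-≤ (suc n) P? g X unique bound with P? n
... | no _  = subst (_≤ X) (sym (+-identityʳ _)) (sum-𝟙-unique-≤ n P? g X unique bound)
... | yes p = subst (λ y → y + 1 * g n ≤ X) (sym earlier-vanish) (subst (_≤ X) (sym (*-identityˡ (g n))) (bound n p))
  where
  earlier-vanish : ∑[ j < n ] (𝟙[ P? j ] * g j) ≡ 0
  earlier-vanish = trans (sum-cong n (λ j j<n → cong (_* g j) (𝟙-no (P? j) (λ pj → <-irrefl (unique j n pj p) j<n))))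
                         (sum-zero n)

below-average : ∀ n {P : ℕ → Set} (P? : ∀ d → Dec (P d)) (h : ℕ → ℕ) {K X} →
                ∑[ d < n ] (𝟙[ P? d ] * h d) ≤ X → 1 ≤ K → K ≤ ∑[ d < n ] 𝟙[ P? d ] →
                ∃ λ d → d < n × P d × h d * K ≤ X
below-average n {P} P? h {K} {X} total K≥1 K≤C with anyUpTo? {P = λ d → P d × h d * K ≤ X} (λ d → P? d ×-dec (h d * K ≤? X)) n
... | yes (d , d<n , pd , hd) = d , d<n , pd , hd
... | no none = ⊥-elim (<-irrefl refl (begin-strict
      C * X                         <⟨ +-monoˡ-≤ (C * X) (≤-trans K≥1 K≤C) ⟩
      C + C * X                     ≡⟨ *-suc C X ⟨
      C * suc X                     ≡⟨ sum-*ʳ n (suc X) (λ d → 𝟙[ P? d ]) ⟨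
      ∑[ d < n ] (𝟙[ P? d ] * suc X) ≤⟨ sum-mono-≤ n above ⟩
      ∑[ d < n ] (𝟙[ P? d ] * h d * K) ≡⟨ sum-*ʳ n K (λ d → 𝟙[ P? d ] * h d) ⟩
      (∑[ d < n ] (𝟙[ P? d ] * h d)) * K ≤⟨ *-mono-≤ total K≤C ⟩
      X * C                         ≡⟨ *-comm X C ⟩
      C * X                         ∎))
  where
  open ≤-Reasoning
  C = ∑[ d < n ] 𝟙[ P? d ]
  above : ∀ d → d < n → 𝟙[ P? d ] * suc X ≤ 𝟙[ P? d ] * h d * K
  above d d<n with P? d
  ... | no _  = z≤n
  ... | yes pd = subst₂ _≤_ (sym (*-identityˡ (suc X))) (cong (_* K) (sym (*-identityˡ (h d))))
                        (≰⇒> {h d * K} {X} (λ hd → none (d , d<n , pd , hd)))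

sum-𝟙-<≡⊓ : ∀ n x → ∑[ t < n ] 𝟙[ t <? x ] ≡ n ⊓ x
sum-𝟙-<≡⊓ zero    x = refl
sum-𝟙-<≡⊓ (suc n) x with n <? x
... | yes n<x = trans (cong (_+ 1) (trans (sum-𝟙-<≡⊓ n x) (m≤n⇒m⊓n≡m (<⇒≤ n<x))))
                      (trans (+-comm n 1) (sym (m≤n⇒m⊓n≡m n<x)))
... | no n≮x  = trans (trans (+-identityʳ _) (trans (sum-𝟙-<≡⊓ n x) (m≥n⇒m⊓n≡n (≮⇒≥ n≮x))))
                      (sym (m≥n⇒m⊓n≡n (≤-trans (≮⇒≥ n≮x) (n≤1+n n))))

module _ (P : ℕ) .{{_ : NonZero P}} (x : ℕ) where

  residues-rotate : ∀ (g : ℕ → ℕ) A → ∑[ t < P ] g ((A + t) % P) ≡ sum P g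
  residues-rotate g zero    = sum-cong P (λ t t<P → cong g (m<n⇒m%n≡m t<P))
  residues-rotate g (suc A) = begin
    ∑[ t < P ] g ((suc A + t) % P) ≡⟨ sum-cong P (λ t _ → cong (λ y → g (y % P)) (sym (+-suc A t))) ⟩
    ∑[ t < P ] h (suc t)           ≡⟨ +-cancelʳ-≡ _ _ _ (trans (sum-rotate P h) (cong (sum P h +_) h-periodic)) ⟩
    sum P h                        ≡⟨ residues-rotate g A ⟩
    sum P g                        ∎
    where
    open ≡-Reasoning
    h : ℕ → ℕ
    h t = g ((A + t) % P)
    h-periodic : h P ≡ h 0
    h-periodic = cong g (trans ([m+n]%n≡m%n A P) (cong (_% P) (sym (+-identityʳ A))))

  residues-<-period : ∀ A → ∑[ t < P ] 𝟙[ (A + t) % P <? x ] ≤ x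
  residues-<-period A = begin
    ∑[ t < P ] 𝟙[ (A + t) % P <? x ] ≡⟨ residues-rotate (λ y → 𝟙[ y <? x ]) A ⟩
    ∑[ t < P ] 𝟙[ t <? x ]           ≡⟨ sum-𝟙-<≡⊓ P x ⟩
    P ⊓ x                            ≤⟨ m⊓n≤n P x ⟩
    x                                ∎
    where open ≤-Reasoning

  residues-<-periods : ∀ q A → ∑[ t < q * P ] 𝟙[ (A + t) % P <? x ] ≤ q * x
  residues-<-periods q A = begin
    ∑[ t < q * P ] 𝟙[ (A + t) % P <? x ]                         ≡⟨ sum-blocks q P _ ⟩
    ∑[ c < q ] (∑[ t < P ] 𝟙[ (A + (c * P + t)) % P <? x ])      ≡⟨ sum-cong q (λ c _ → sum-cong P (λ t _ →
                                                                      cong (λ y → 𝟙[ y % P <? x ]) (sym (+-assoc A (c * P) t)))) ⟩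
    ∑[ c < q ] (∑[ t < P ] 𝟙[ (A + c * P + t) % P <? x ])        ≤⟨ sum-≤-* q x (λ c _ → residues-<-period (A + c * P)) ⟩
    q * x                                                        ∎
    where open ≤-Reasoning

  residues-< : ∀ A L → (∑[ t < L ] 𝟙[ (A + t) % P <? x ]) * P ≤ x * (L + P)
  residues-< A L = begin
    (∑[ t < L ] 𝟙[ (A + t) % P <? x ]) * P      ≤⟨ *-monoˡ-≤ P (sum-shift-≤ _ 0 L (q * P) (<⇒≤ L<qP)) ⟩
    (∑[ t < q * P ] 𝟙[ (A + t) % P <? x ]) * P  ≤⟨ *-monoˡ-≤ P (residues-<-periods q A) ⟩
    q * x * P                                 ≡⟨ *-comm-middle (L / P) x P ⟩
    x * (L / P * P + P)                       ≤⟨ *-monoʳ-≤ x (+-monoˡ-≤ P (m/n*n≤m L P)) ⟩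
    x * (L + P)                               ∎
    where
    open ≤-Reasoning
    q = suc (L / P)
    L<qP : L < q * P
    L<qP = begin-strict
      L                   ≡⟨ m≡m%n+[m/n]*n L P ⟩
      L % P + L / P * P   <⟨ +-monoˡ-< (L / P * P) (m%n<n L P) ⟩
      q * P               ∎
    *-comm-middle : ∀ q x P → suc q * x * P ≡ x * (q * P + P)
    *-comm-middle = solve-∀

n<m^n : ∀ {m} n → 1 < m → n < m ^ n
n<m^n zero    1<m = z<s
n<m^n {m} (suc n) 1<m = ≤-<-trans (n<m^n n 1<m) (^-monoʳ-< m 1<m (n<1+n n))

module _ (b : ℕ) .{{_ : NonZero b}} where

  -- the digit of b ^ j in N is 0 (N % b ^ (j + 1) < b ^ j) and is not a leading zero (b ^ (j + 1) ≤ N)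
  ZeroDigit : ℕ → ℕ → Set
  ZeroDigit j N = b ^ suc j ≤ N × (N % b ^ suc j) {{m^n≢0 b (suc j)}} < b ^ j

  zeroDigit? : ∀ j N → Dec (ZeroDigit j N)
  zeroDigit? j N = (b ^ suc j ≤? N) ×-dec ((N % b ^ suc j) {{m^n≢0 b (suc j)}} <? b ^ j)

  zeroDigit-at : ∀ j {q x} → 1 ≤ q → x < b ^ j → ZeroDigit j (x + q * b ^ suc j)
  zeroDigit-at j {q} {x} q≥1 x<bʲ =
    ≤-trans (m≤n*m (b ^ suc j) q {{>-nonZero q≥1}}) (m≤n+m (q * b ^ suc j) x) ,
    subst (_< b ^ j) (sym (trans ([m+kn]%n≡m%n x q (b ^ suc j)) (m<n⇒m%n≡m x<bʲ⁺¹))) x<bʲ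
    where
    instance _ = m^n≢0 b (suc j)
    x<bʲ⁺¹ : x < b ^ suc j
    x<bʲ⁺¹ = <-≤-trans x<bʲ (m≤n*m (b ^ j) b)

  zeroDigit-run : ∀ j {N} L → ZeroDigit j N → 1 ≤ L → L ≤ b ^ j →
                  ∃ λ a → a ≤ N × N < a + L × (∀ v → v < L → ZeroDigit j (a + v))
  zeroDigit-run j {N} L (bʲ⁺¹≤N , r<bʲ) L≥1 L≤bʲ = run (r + L ≤? b ^ j)
    where
    instance _ = m^n≢0 b (suc j)
    r = N % b ^ suc j
    q = N / b ^ suc j
    q≥1 = m≥n⇒m/n>0 bʲ⁺¹≤N
    N≡ : N ≡ r + q * b ^ suc j
    N≡ = m≡m%n+[m/n]*n N (b ^ suc j)
    +-swapʳ : ∀ a b c → a + b + c ≡ a + c + b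
    +-swapʳ = solve-∀
    run : Dec (r + L ≤ b ^ j) → ∃ λ a → a ≤ N × N < a + L × (∀ v → v < L → ZeroDigit j (a + v))
    run (yes fits) = N , ≤-refl , m<m+n N L≥1 , λ v v<L →
      subst (ZeroDigit j) (trans (+-swapʳ r v (q * b ^ suc j)) (cong (_+ v) (sym N≡)))
            (zeroDigit-at j q≥1 (<-≤-trans (+-monoʳ-< r v<L) fits))
    run (no overflows) = a , a≤N , N<a+L , λ v v<L →
      subst (ZeroDigit j) (+-swapʳ (b ^ j ∸ L) v (q * b ^ suc j))
            (zeroDigit-at j q≥1 (<-≤-trans (+-monoʳ-< (b ^ j ∸ L) v<L) (≤-reflexive (m∸n+n≡m L≤bʲ))))
      where
      a = b ^ j ∸ L + q * b ^ suc j
      a≤N : a ≤ N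
      a≤N = subst (a ≤_) (sym N≡) (+-monoˡ-≤ (q * b ^ suc j)
              (m≤n+o⇒m∸n≤o (b ^ j) L (≤-trans (<⇒≤ (≰⇒> overflows)) (≤-reflexive (+-comm r L)))))
      N<a+L : N < a + L
      N<a+L = subst₂ _<_ (sym N≡) (+-swapʳ (b ^ j ∸ L) L (q * b ^ suc j))
                (+-monoˡ-< (q * b ^ suc j) (subst (r <_) (sym (m∸n+n≡m L≤bʲ)) r<bʲ))

  %-*-split : ∀ N Q .{{_ : NonZero Q}} .{{_ : NonZero (b * Q)}} → N % (b * Q) ≡ N % b + b * (N / b % Q)
  %-*-split N Q = begin
    N % (b * Q)                       ≡⟨ %-congˡ N≡ ⟩
    (d + b * r + q * (b * Q)) % (b * Q) ≡⟨ [m+kn]%n≡m%n (d + b * r) q (b * Q) ⟩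
    (d + b * r) % (b * Q)             ≡⟨ m<n⇒m%n≡m d+br<bQ ⟩
    d + b * r                         ∎
    where
    open ≡-Reasoning
    d = N % b
    r = N / b % Q
    q = N / b / Q
    N≡ : N ≡ d + b * r + q * (b * Q)
    N≡ = begin
      N                          ≡⟨ m≡m%n+[m/n]*n N b ⟩
      d + N / b * b              ≡⟨ cong (λ z → d + z * b) (m≡m%n+[m/n]*n (N / b) Q) ⟩
      d + (r + q * Q) * b        ≡⟨ regroup d r q Q b ⟩
      d + b * r + q * (b * Q)    ∎
      where
      regroup : ∀ d r q Q b → d + (r + q * Q) * b ≡ d + b * r + q * (b * Q)
      regroup = solve-∀
    d+br<bQ : d + b * r < b * Q
    d+br<bQ = <-≤-trans (+-monoˡ-< (b * r) (m%n<n N b))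
                        (subst (_≤ b * Q) (*-suc b r) (*-monoʳ-≤ b (m%n<n (N / b) Q)))

  zeroDigit-/ : ∀ j {N} → ZeroDigit j (N / b) → ZeroDigit (suc j) N
  zeroDigit-/ j {N} (bʲ⁺¹≤N/b , r<bʲ) =
    ≤-trans (*-monoʳ-≤ b bʲ⁺¹≤N/b) (subst (_≤ N) (*-comm (N / b) b) (m/n*n≤m N b)) ,
    (begin-strict
      N % b ^ suc (suc j)              ≡⟨ %-*-split N (b ^ suc j) ⟩
      N % b + b * (N / b % b ^ suc j)  <⟨ +-monoˡ-< _ (m%n<n N b) ⟩
      b + b * (N / b % b ^ suc j)      ≡⟨ *-suc b _ ⟨
      b * suc (N / b % b ^ suc j)      ≤⟨ *-monoʳ-≤ b r<bʲ ⟩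
      b * b ^ j                        ∎)
    where
    open ≤-Reasoning
    instance _ = m^n≢0 b (suc j)
    instance _ = m^n≢0 b (suc (suc j))

  zeroDigit⇒< : 1 < b → ∀ j {N} → ZeroDigit j N → j < N
  zeroDigit⇒< 1<b j (bʲ⁺¹≤N , _) = <-≤-trans (<-trans (n<1+n j) (n<m^n (suc j) 1<b)) bʲ⁺¹≤N

  zeroDigit-count : ∀ j A L → (∑[ t < L ] 𝟙[ zeroDigit? j (A + t) ]) * b ≤ L + b * b ^ j
  zeroDigit-count j A L = *-cancelʳ-≤ _ _ (b ^ j) {{m^n≢0 b j}} (begin
    (∑[ t < L ] 𝟙[ zeroDigit? j (A + t) ]) * b * b ^ j    ≡⟨ *-assoc (∑[ t < L ] 𝟙[ zeroDigit? j (A + t) ]) b (b ^ j) ⟩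
    (∑[ t < L ] 𝟙[ zeroDigit? j (A + t) ]) * b ^ suc j    ≤⟨ *-monoˡ-≤ (b ^ suc j) (sum-mono-≤ L (λ t _ → zero⇒residue t)) ⟩
    (∑[ t < L ] 𝟙[ (A + t) % b ^ suc j <? b ^ j ]) * b ^ suc j ≤⟨ residues-< (b ^ suc j) (b ^ j) A L ⟩
    b ^ j * (L + b ^ suc j)                             ≡⟨ *-comm (b ^ j) _ ⟩
    (L + b * b ^ j) * b ^ j                             ∎)
    where
    open ≤-Reasoning
    instance _ = m^n≢0 b (suc j)
    zero⇒residue : ∀ t → 𝟙[ zeroDigit? j (A + t) ] ≤ 𝟙[ (A + t) % b ^ suc j <? b ^ j ]
    zero⇒residue t = 𝟙-mono proj₂ (zeroDigit? j (A + t)) ((A + t) % b ^ suc j <? b ^ j)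

  noZeroDigit⇒ZeroFreeIn : 1 < b → ∀ N → 1 ≤ N → (∀ j → ¬ ZeroDigit j N) → ZeroFreeIn b N
  noZeroDigit⇒ZeroFreeIn 1<b = <-rec (λ N → 1 ≤ N → (∀ j → ¬ ZeroDigit j N) → ZeroFreeIn b N) expand
    where
    expand : ∀ N → (∀ {M} → M < N → 1 ≤ M → (∀ j → ¬ ZeroDigit j M) → ZeroFreeIn b M) →
             1 ≤ N → (∀ j → ¬ ZeroDigit j N) → ZeroFreeIn b N
    expand N rec N≥1 none with N <? b
    ... | yes N<b = N ∷ [] , (λ ()) , (N≥1 , N<b) ∷ [] , sym (trans (cong (N +_) (*-zeroʳ b)) (+-identityʳ N))
    ... | no N≮b with rec (m/n<m N b {{>-nonZero N≥1}} 1<b) (m≥n⇒m/n>0 b≤N) (λ j z → none (suc j) (zeroDigit-/ j z))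
      where b≤N = ≮⇒≥ N≮b
    ...   | cs , _ , digits , N/b≡ =
      N % b ∷ cs , (λ ()) , (lowest≥1 , m%n<n N b) ∷ digits ,
      trans (m≡m%n+[m/n]*n N b) (cong (N % b +_) (trans (*-comm (N / b) b) (cong (b *_) N/b≡)))
      where
      lowest≥1 : 1 ≤ N % b
      lowest≥1 with N % b in lowest
      ... | suc _ = s≤s z≤n
      ... | zero  = ⊥-elim (none 0 (subst (_≤ N) (sym (*-identityʳ b)) (≮⇒≥ N≮b) ,
                      subst (_< 1) (trans (sym lowest) (%-congʳ {{_}} {{m^n≢0 b 1}} (sym (*-identityʳ b)))) z<s))

-- The sums over (i, j) stop at j < J; for N < J nothing is lost, as zero digits of N sit at places j < N.
module Descent (k : ℕ) (B : ℕ → ℕ) (T J : ℕ)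
               (16≤T : 16 ≤ T) (160k≤T : 160 * k ≤ T) (T≤B : ∀ i → T ≤ B i) where

  instance
    T-nonZero : NonZero T
    T-nonZero = >-nonZero (≤-trans (s≤s z≤n) 16≤T)

  2≤T : 2 ≤ T
  2≤T = ≤-trans (s≤s (s≤s z≤n)) 16≤T

  4≤T : 4 ≤ T
  4≤T = ≤-trans (s≤s (s≤s (s≤s (s≤s z≤n)))) 16≤T

  1<B : ∀ i → 1 < B i
  1<B i = ≤-trans 2≤T (T≤B i)

  B-nonZero : ∀ i → NonZero (B i)
  B-nonZero i = >-nonZero (≤-trans (>-nonZero⁻¹ T) (T≤B i))

  Bad : ℕ → ℕ → ℕ → Set
  Bad i = ZeroDigit (B i) {{B-nonZero i}}

  bad? : ∀ i j N → Dec (Bad i j N)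
  bad? i = zeroDigit? (B i) {{B-nonZero i}}

  Threat : ℕ → ℕ → ℕ → Set
  Threat m i j = B i ^ j < T ^ m × T ^ m ≤ B i ^ suc j

  threat? : ∀ m i j → Dec (Threat m i j)
  threat? m i j = (B i ^ j <? T ^ m) ×-dec (T ^ m ≤? B i ^ suc j)

  NewThreat : ℕ → ℕ → ℕ → Set
  NewThreat m i j = Threat m i j × ¬ Threat (suc m) i j

  newThreat? : ∀ m i j → Dec (NewThreat m i j)
  newThreat? m i j = threat? m i j ×-dec ¬? (threat? (suc m) i j)

  Lethal : ℕ → ℕ → ℕ → Set
  Lethal m i j = T ^ m ≤ B i ^ j × B i ^ j < T ^ suc m

  lethal? : ∀ m i j → Dec (Lethal m i j)
  lethal? m i j = (T ^ m ≤? B i ^ j) ×-dec (B i ^ j <? T ^ suc m)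

  levelsAbove : ℕ → ℕ → ℕ
  levelsAbove m x = ∑[ l < m ] 𝟙[ x <? T ^ l ]

  weight : ℕ → ℕ → ℕ
  weight m x = 4 ^ levelsAbove m x

  ∑ᵢⱼ : (ℕ → ℕ → ℕ) → ℕ
  ∑ᵢⱼ g = ∑[ i < k ] (∑[ j < J ] g i j)

  threatWeight : ℕ → ℕ → ℕ
  threatWeight m N = ∑ᵢⱼ λ i j → 𝟙[ threat? m i j ] * 𝟙[ bad? i j N ] * weight m (B i ^ j)

  newThreatWeight : ℕ → ℕ → ℕ
  newThreatWeight m N = ∑ᵢⱼ λ i j → 𝟙[ newThreat? m i j ] * 𝟙[ bad? i j N ] * weight m (B i ^ j)

  lethalCount : ℕ → ℕ → ℕ
  lethalCount m N = ∑ᵢⱼ λ i j → 𝟙[ lethal? m i j ] * 𝟙[ bad? i j N ]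

  potential : ℕ → ℕ → ℕ
  potential m A = ∑[ t < T ^ m ] threatWeight m (A + t)

  Clean : ℕ → ℕ → Set
  Clean m A = ∀ t → t < T ^ m → ∀ i → i < k → ∀ j → T ^ m ≤ B i ^ j → ¬ Bad i j (A + t)

  ∑ᵢⱼ-mono-≤ : ∀ g h → (∀ i j → g i j ≤ h i j) → ∑ᵢⱼ g ≤ ∑ᵢⱼ h
  ∑ᵢⱼ-mono-≤ g h le = sum-mono-≤ k (λ i _ → sum-mono-≤ J (λ j _ → le i j))

  ∑ᵢⱼ-*ˡ : ∀ c g → ∑ᵢⱼ (λ i j → c * g i j) ≡ c * ∑ᵢⱼ g
  ∑ᵢⱼ-*ˡ c g = trans (sum-cong k (λ i _ → sum-*ˡ J c (g i))) (sum-*ˡ k c (λ i → sum J (g i)))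

  ∑ᵢⱼ-+ : ∀ g h → ∑ᵢⱼ (λ i j → g i j + h i j) ≡ ∑ᵢⱼ g + ∑ᵢⱼ h
  ∑ᵢⱼ-+ g h = trans (sum-cong k (λ i _ → sum-+ J (g i) (h i))) (sum-+ k _ _)

  weight-step : ∀ m x → x < T ^ m → weight (suc m) x ≡ 4 * weight m x
  weight-step m x x<Tᵐ = cong (4 ^_) (trans (cong (levelsAbove m x +_) (𝟙-yes (x <? T ^ m) x<Tᵐ))
                                             (+-comm (levelsAbove m x) 1))

  levelsAbove-≥ : ∀ m x → T ^ m ≤ x → levelsAbove m x ≡ 0
  levelsAbove-≥ m x Tᵐ≤x =
    trans (sum-cong m (λ l l<m → 𝟙-no (x <? T ^ l) (≤⇒≯ (≤-trans (^-monoʳ-≤ T (<⇒≤ l<m)) Tᵐ≤x)))) (sum-zero m)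

  T^levelsAbove : ∀ m x → x < T ^ m → T ^ levelsAbove m x * x < T ^ m
  T^levelsAbove zero    x x<1 = subst (_< 1) (sym (+-identityʳ x)) x<1
  T^levelsAbove (suc m) x x<Tᵐ⁺¹ with x <? T ^ m
  ... | yes x<Tᵐ = begin-strict
    T ^ (levelsAbove m x + 1) * x   ≡⟨ cong (λ e → T ^ e * x) (+-comm (levelsAbove m x) 1) ⟩
    T * T ^ levelsAbove m x * x     ≡⟨ *-assoc T _ x ⟩
    T * (T ^ levelsAbove m x * x)   <⟨ *-monoʳ-< T (T^levelsAbove m x x<Tᵐ) ⟩
    T * T ^ m                       ∎
    where open ≤-Reasoning
  ... | no x≮Tᵐ = subst (λ e → T ^ e * x < T ^ suc m)
                        (sym (trans (+-identityʳ _) (levelsAbove-≥ m x (≮⇒≥ x≮Tᵐ))))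
                        (subst (_< T ^ suc m) (sym (+-identityʳ x)) x<Tᵐ⁺¹)

  threatWeight-step : ∀ m N → 4 * threatWeight m N ≤ threatWeight (suc m) N + 4 * newThreatWeight m N
  threatWeight-step m N = begin
    4 * threatWeight m N                                    ≡⟨ ∑ᵢⱼ-*ˡ 4 _ ⟨
    ∑ᵢⱼ (λ i j → 4 * term m i j)                            ≤⟨ ∑ᵢⱼ-mono-≤ _ _ term-step ⟩
    ∑ᵢⱼ (λ i j → term (suc m) i j + 4 * newTerm i j)        ≡⟨ ∑ᵢⱼ-+ _ _ ⟩
    threatWeight (suc m) N + ∑ᵢⱼ (λ i j → 4 * newTerm i j)  ≡⟨ cong (threatWeight (suc m) N +_) (∑ᵢⱼ-*ˡ 4 _) ⟩
    threatWeight (suc m) N + 4 * newThreatWeight m N        ∎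
    where
    open ≤-Reasoning
    term : ℕ → ℕ → ℕ → ℕ
    term m i j = 𝟙[ threat? m i j ] * 𝟙[ bad? i j N ] * weight m (B i ^ j)
    newTerm : ℕ → ℕ → ℕ
    newTerm i j = 𝟙[ newThreat? m i j ] * 𝟙[ bad? i j N ] * weight m (B i ^ j)
    split : ∀ {P Q : Set} (p? : Dec P) (q? : Dec Q) c x y → (P → Q → y ≡ 4 * x) →
            4 * (𝟙[ p? ] * c * x) ≤ 𝟙[ q? ] * c * y + 4 * (𝟙[ p? ×-dec ¬? q? ] * c * x)
    split (no _)  q?      c x y eq = z≤n
    split (yes p) (no ¬q) c x y eq = m≤n+m (4 * (1 * c * x)) (0 * c * y)
    split (yes p) (yes q) c x y eq = ≤-reflexive (begin-equality
      4 * (1 * c * x)   ≡⟨ *-comm-middle c x ⟩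
      1 * c * (4 * x)   ≡⟨ cong (1 * c *_) (eq p q) ⟨
      1 * c * y         ≡⟨ +-identityʳ _ ⟨
      1 * c * y + 0     ∎)
      where
      *-comm-middle : ∀ c x → 4 * (1 * c * x) ≡ 1 * c * (4 * x)
      *-comm-middle = solve-∀
    term-step : ∀ i j → 4 * term m i j ≤ term (suc m) i j + 4 * newTerm i j
    term-step i j = split (threat? m i j) (threat? (suc m) i j) (𝟙[ bad? i j N ]) _ _
                          (λ threat _ → weight-step m (B i ^ j) (proj₁ threat))

  lethal⇒threat : ∀ m i j → Lethal m i j → Threat (suc m) i j
  lethal⇒threat m i j (Tᵐ≤Bʲ , Bʲ<Tᵐ⁺¹) = Bʲ<Tᵐ⁺¹ , *-mono-≤ (T≤B i) Tᵐ≤Bʲ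

  lethalCount≤threatWeight : ∀ m N → lethalCount m N ≤ threatWeight (suc m) N
  lethalCount≤threatWeight m N = ∑ᵢⱼ-mono-≤ _ _ le
    where
    le : ∀ i j → 𝟙[ lethal? m i j ] * 𝟙[ bad? i j N ] ≤ 𝟙[ threat? (suc m) i j ] * 𝟙[ bad? i j N ] * weight (suc m) (B i ^ j)
    le i j = begin
      𝟙[ lethal? m i j ] * 𝟙[ bad? i j N ]                                       ≡⟨ *-identityʳ _ ⟨
      𝟙[ lethal? m i j ] * 𝟙[ bad? i j N ] * 1
        ≤⟨ *-mono-≤ (*-monoˡ-≤ _ lethal≤threat) (m^n>0 4 (levelsAbove (suc m) (B i ^ j))) ⟩
      𝟙[ threat? (suc m) i j ] * 𝟙[ bad? i j N ] * weight (suc m) (B i ^ j)       ∎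
      where
      open ≤-Reasoning
      lethal≤threat = 𝟙-mono (lethal⇒threat m i j) (lethal? m i j) (threat? (suc m) i j)

  newThreats-≮ : ∀ m i {j j′} → NewThreat m i j → NewThreat m i j′ → ¬ j < j′
  newThreats-≮ m i ((_ , Tᵐ≤Bʲ⁺¹) , _) ((Bʲ′<Tᵐ , _) , not-threat) j<j′ =
    not-threat (≤-trans Bʲ′<Tᵐ (^-monoʳ-≤ T (n≤1+n m)) ,
                *-mono-≤ (T≤B i) (≤-trans Tᵐ≤Bʲ⁺¹ (^-monoʳ-≤ (B i) {{B-nonZero i}} j<j′)))

  newThreat-unique : ∀ m i j j′ → NewThreat m i j → NewThreat m i j′ → j ≡ j′
  newThreat-unique m i j j′ new new′ =
    ≤-antisym (≮⇒≥ (newThreats-≮ m i new′ new)) (≮⇒≥ (newThreats-≮ m i new new′))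

  threat-weight*scale : ∀ m i j → Threat m i j → weight m (B i ^ j) * B i ^ j * T ≤ T ^ suc m
  threat-weight*scale m i j (Bʲ<Tᵐ , _) = begin
    4 ^ c * B i ^ j * T   ≤⟨ *-monoˡ-≤ T (*-monoˡ-≤ (B i ^ j) (^-monoˡ-≤ c 4≤T)) ⟩
    T ^ c * B i ^ j * T   ≤⟨ *-monoˡ-≤ T (<⇒≤ (T^levelsAbove m (B i ^ j) Bʲ<Tᵐ)) ⟩
    T ^ m * T             ≡⟨ *-comm (T ^ m) T ⟩
    T ^ suc m             ∎
    where
    open ≤-Reasoning
    c = levelsAbove m (B i ^ j)

  threat-weight*T : ∀ m i j → Threat m i j → weight m (B i ^ j) * T ≤ 4 * B i
  threat-weight*T m i j (Bʲ<Tᵐ , Tᵐ≤Bʲ⁺¹) with levelsAbove m (B i ^ j) | T^levelsAbove m (B i ^ j) Bʲ<Tᵐ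
  ... | zero  | _ = ≤-trans (≤-reflexive (*-identityˡ T)) (≤-trans (T≤B i) (m≤n*m (B i) 4))
  ... | suc c | Tᶜ⁺¹Bʲ<Tᵐ = begin
    4 * 4 ^ c * T     ≤⟨ *-monoˡ-≤ T (*-monoʳ-≤ 4 (^-monoˡ-≤ c 4≤T)) ⟩
    4 * T ^ c * T     ≡⟨ *-assoc 4 (T ^ c) T ⟩
    4 * (T ^ c * T)   ≡⟨ cong (4 *_) (*-comm (T ^ c) T) ⟩
    4 * T ^ suc c     ≤⟨ *-monoʳ-≤ 4 (<⇒≤ Tᶜ⁺¹<B) ⟩
    4 * B i           ∎
    where
    open ≤-Reasoning
    Tᶜ⁺¹<B : T ^ suc c < B i
    Tᶜ⁺¹<B = *-cancelʳ-< _ (T ^ suc c) (B i) (<-≤-trans Tᶜ⁺¹Bʲ<Tᵐ Tᵐ≤Bʲ⁺¹)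

  threat-badWeight : ∀ m i j A → Threat m i j →
    (∑[ t < T ^ suc m ] 𝟙[ bad? i j (A + t) ]) * weight m (B i ^ j) * T ≤ 5 * T ^ suc m
  threat-badWeight m i j A threat = *-cancelʳ-≤ _ _ (B i) {{B-nonZero i}} (begin
    C * W * T * B i                   ≡⟨ regroup C (B i) W T ⟩
    (C * B i) * (W * T)               ≤⟨ *-monoˡ-≤ (W * T) (zeroDigit-count (B i) {{B-nonZero i}} j A L) ⟩
    (L + B i * B i ^ j) * (W * T)     ≡⟨ *-distribʳ-+ (W * T) L (B i * B i ^ j) ⟩
    L * (W * T) + B i * B i ^ j * (W * T)
                                      ≤⟨ +-monoˡ-≤ _ (*-monoʳ-≤ L (threat-weight*T m i j threat)) ⟩
    L * (4 * B i) + B i * B i ^ j * (W * T)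
                                      ≡⟨ cong (L * (4 * B i) +_) (regroup′ (B i) (B i ^ j) W T) ⟩
    L * (4 * B i) + B i * (W * B i ^ j * T)
                                      ≤⟨ +-monoʳ-≤ (L * (4 * B i)) (*-monoʳ-≤ (B i) (threat-weight*scale m i j threat)) ⟩
    L * (4 * B i) + B i * L           ≡⟨ collect L (B i) ⟩
    5 * L * B i                       ∎)
    where
    open ≤-Reasoning
    L = T ^ suc m
    W = weight m (B i ^ j)
    C = ∑[ t < L ] 𝟙[ bad? i j (A + t) ]
    regroup : ∀ a b x y → a * x * y * b ≡ (a * b) * (x * y)
    regroup = solve-∀
    regroup′ : ∀ b x y z → b * x * (y * z) ≡ b * (y * x * z)
    regroup′ = solve-∀
    collect : ∀ a b → a * (4 * b) + b * a ≡ 5 * a * b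
    collect = solve-∀

  newThreatWeight-block : ∀ m A → (∑[ t < T ^ suc m ] newThreatWeight m (A + t)) * T ≤ k * (5 * T ^ suc m)
  newThreatWeight-block m A = begin
    (∑[ t < L ] newThreatWeight m (A + t)) * T                          ≡⟨ cong (_* T) (sum-swap L k _) ⟩
    (∑[ i < k ] (∑[ t < L ] (∑[ j < J ] newTerm t i j))) * T           ≡⟨ sum-*ʳ k T _ ⟨
    ∑[ i < k ] ((∑[ t < L ] (∑[ j < J ] newTerm t i j)) * T)           ≤⟨ sum-≤-* k (5 * L) (λ i _ → per-base i) ⟩
    k * (5 * L)                                                       ∎
    where
    open ≤-Reasoning
    L = T ^ suc m
    newTerm : ℕ → ℕ → ℕ → ℕ
    newTerm t i j = 𝟙[ newThreat? m i j ] * 𝟙[ bad? i j (A + t) ] * weight m (B i ^ j)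
    badWeight : ℕ → ℕ → ℕ
    badWeight i j = (∑[ t < L ] 𝟙[ bad? i j (A + t) ]) * weight m (B i ^ j) * T
    pull-out : ∀ i j → (∑[ t < L ] newTerm t i j) * T ≡ 𝟙[ newThreat? m i j ] * badWeight i j
    pull-out i j = begin-equality
      (∑[ t < L ] newTerm t i j) * T
        ≡⟨ cong (_* T) (sum-cong L (λ t _ → *-assoc 𝟙[ newThreat? m i j ] _ _)) ⟩
      (∑[ t < L ] (𝟙[ newThreat? m i j ] * (𝟙[ bad? i j (A + t) ] * weight m (B i ^ j)))) * T
        ≡⟨ cong (_* T) (sum-*ˡ L 𝟙[ newThreat? m i j ] _) ⟩
      𝟙[ newThreat? m i j ] * (∑[ t < L ] (𝟙[ bad? i j (A + t) ] * weight m (B i ^ j))) * T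
        ≡⟨ cong (λ x → 𝟙[ newThreat? m i j ] * x * T) (sum-*ʳ L (weight m (B i ^ j)) _) ⟩
      𝟙[ newThreat? m i j ] * ((∑[ t < L ] 𝟙[ bad? i j (A + t) ]) * weight m (B i ^ j)) * T
        ≡⟨ *-assoc 𝟙[ newThreat? m i j ] _ T ⟩
      𝟙[ newThreat? m i j ] * badWeight i j ∎
    per-base : ∀ i → (∑[ t < L ] (∑[ j < J ] newTerm t i j)) * T ≤ 5 * L
    per-base i = begin
      (∑[ t < L ] (∑[ j < J ] newTerm t i j)) * T          ≡⟨ cong (_* T) (sum-swap L J _) ⟩
      (∑[ j < J ] (∑[ t < L ] newTerm t i j)) * T          ≡⟨ sum-*ʳ J T _ ⟨
      ∑[ j < J ] ((∑[ t < L ] newTerm t i j) * T)          ≡⟨ sum-cong J (λ j _ → pull-out i j) ⟩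
      ∑[ j < J ] (𝟙[ newThreat? m i j ] * badWeight i j) ≤⟨ sum-𝟙-unique-≤ J (newThreat? m i) (badWeight i) (5 * L)
                                                              (newThreat-unique m i)
                                                              (λ j new → threat-badWeight m i j A (proj₁ new)) ⟩
      5 * L                                              ∎

  lethalCount>0⇒ : ∀ m N → 0 < lethalCount m N → ∃ λ i → i < k × ∃ λ j → j < J × Lethal m i j × Bad i j N
  lethalCount>0⇒ m N lc>0 with sum>0⇒ k _ lc>0
  ... | i , i<k , >0 with sum>0⇒ J _ >0
  ...   | j , j<J , >0′ = i , i<k , j , j<J , both (lethal? m i j) (bad? i j N) >0′
    where
    both : ∀ {P Q : Set} (p? : Dec P) (q? : Dec Q) → 0 < 𝟙[ p? ] * 𝟙[ q? ] → P × Q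
    both (yes p) (yes q) _ = p , q

  lethalCount≥1 : ∀ m N i j → i < k → j < J → Lethal m i j → Bad i j N → 1 ≤ lethalCount m N
  lethalCount≥1 m N i j i<k j<J lethal bad = begin
    1                                          ≡⟨ cong₂ _*_ (𝟙-yes (lethal? m i j) lethal) (𝟙-yes (bad? i j N) bad) ⟨
    𝟙[ lethal? m i j ] * 𝟙[ bad? i j N ]       ≤⟨ term≤sum J _ j j<J ⟩
    ∑[ j < J ] (𝟙[ lethal? m i j ] * 𝟙[ bad? i j N ]) ≤⟨ term≤sum k _ i i<k ⟩
    lethalCount m N                            ∎
    where open ≤-Reasoning

  blockLethal : ℕ → ℕ → ℕ → ℕ
  blockLethal m A c = ∑[ t < T ^ m ] lethalCount m (A + (c * T ^ m + t))

  -- a zero digit at a place B i ^ j ≥ T ^ m persists along T ^ m consecutive integers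
  lethalBad⇒window : ∀ m A d t i j → t < T ^ m → i < k → j < J → Lethal m i j → Bad i j (A + (suc d * T ^ m + t)) →
                     T ^ m ≤ ∑[ v < 3 * T ^ m ] lethalCount m (A + (d * T ^ m + v))
  lethalBad⇒window m A d t i j t<L i<k j<J lethal bad = begin
    L                                                  ≡⟨ *-identityʳ L ⟨
    L * 1                                              ≡⟨ sum-const L 1 ⟨
    ∑[ _ < L ] 1                                       ≤⟨ sum-mono-≤ L (λ v v<L → lethalCount≥1 m _ i j i<k j<J lethal (run v v<L)) ⟩
    ∑[ v < L ] lethalCount m (a + v)                   ≤⟨ sum-window-≤ (lethalCount m) L (3 * L) W≤a a+L≤W+3L ⟩
    ∑[ v < 3 * L ] lethalCount m (A + d * L + v)       ≡⟨ sum-cong (3 * L) (λ v _ → cong (lethalCount m) (+-assoc A (d * L) v)) ⟩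
    ∑[ v < 3 * L ] lethalCount m (A + (d * L + v))     ∎
    where
    open ≤-Reasoning
    L = T ^ m
    N = A + (suc d * L + t)
    zero-run : ∃ λ a → a ≤ N × N < a + L × (∀ v → v < L → Bad i j (a + v))
    zero-run = zeroDigit-run (B i) {{B-nonZero i}} j L bad (m^n>0 T m) (proj₁ lethal)
    a = proj₁ zero-run
    a≤N = proj₁ (proj₂ zero-run)
    N<a+L = proj₁ (proj₂ (proj₂ zero-run))
    run = proj₂ (proj₂ (proj₂ zero-run))
    W≤a : A + d * L ≤ a
    W≤a = +-cancelʳ-≤ L _ a (<⇒≤ (≤-<-trans (≤-trans (m≤m+n (A + d * L + L) t) (≤-reflexive (next-block A d L t))) N<a+L))
      where
      next-block : ∀ A d L t → A + d * L + L + t ≡ A + (suc d * L + t)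
      next-block = solve-∀
    a+L≤W+3L : a + L ≤ A + d * L + 3 * L
    a+L≤W+3L = begin
      a + L                               ≤⟨ +-monoˡ-≤ L a≤N ⟩
      A + (suc d * L + t) + L             ≡⟨ regroup A d L t ⟩
      A + d * L + (2 * L + t)             ≤⟨ +-monoʳ-≤ (A + d * L) (+-monoʳ-≤ (2 * L) (<⇒≤ t<L)) ⟩
      A + d * L + (2 * L + L)             ≡⟨ cong (A + d * L +_) (+-comm (2 * L) L) ⟩
      A + d * L + 3 * L                   ∎
      where
      regroup : ∀ A d L t → A + (suc d * L + t) + L ≡ A + d * L + (2 * L + t)
      regroup = solve-∀

  killed⇒window : ∀ m A d → 0 < blockLethal m A (suc d) →
                  T ^ m ≤ ∑[ v < 3 * T ^ m ] lethalCount m (A + (d * T ^ m + v))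
  killed⇒window m A d killed =
    let (t , t<L , lc>0) = sum>0⇒ (T ^ m) (λ t → lethalCount m (A + (suc d * T ^ m + t))) killed
        (i , i<k , j , j<J , lethal , bad) = lethalCount>0⇒ m (A + (suc d * T ^ m + t)) lc>0
    in  lethalBad⇒window m A d t i j t<L i<k j<J lethal bad

  killed : ℕ → ℕ → ℕ
  killed m A = ∑[ d < T ∸ 2 ] 𝟙[ 0 <? blockLethal m A (suc d) ]

  killed-count : ∀ m A → killed m A * T ^ m ≤ 3 * ∑[ t < T * T ^ m ] lethalCount m (A + t)
  killed-count m A = begin
    killed m A * L                                               ≡⟨ sum-*ʳ (T ∸ 2) L _ ⟨
    ∑[ d < T ∸ 2 ] (𝟙[ 0 <? blockLethal m A (suc d) ] * L)
      ≤⟨ sum-mono-≤ (T ∸ 2) (λ d _ → window d (0 <? blockLethal m A (suc d))) ⟩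
    ∑[ d < T ∸ 2 ] (∑[ v < 3 * L ] lethalCount m (A + (d * L + v)))
      ≤⟨ sum-windows-≤ (T ∸ 2) L T (λ t → lethalCount m (A + t)) inner ⟩
    3 * ∑[ t < T * L ] lethalCount m (A + t)                     ∎
    where
    open ≤-Reasoning
    L = T ^ m
    inner : 2 + (T ∸ 2) ≤ T
    inner = ≤-reflexive (m+[n∸m]≡n 2≤T)
    window : ∀ d (killed? : Dec (0 < blockLethal m A (suc d))) →
             𝟙[ killed? ] * L ≤ ∑[ v < 3 * L ] lethalCount m (A + (d * L + v))
    window d (no _)       = z≤n
    window d (yes killed) = ≤-trans (≤-reflexive (*-identityˡ L)) (killed⇒window m A d killed)

  subblockPotential : ℕ → ℕ → ℕ
  subblockPotential m A = ∑[ c < T ] potential m (A + c * T ^ m)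

  subblockPotential-bound : ∀ m A → 8 * potential (suc m) A ≤ T ^ suc m → 16 * subblockPotential m A ≤ T ^ suc m
  subblockPotential-bound m A small = *-cancelˡ-≤ 2 (begin
    2 * (16 * X)                     ≡⟨ *-assoc 2 16 X ⟨
    32 * X                           ≡⟨ *-assoc 8 4 X ⟩
    8 * (4 * X)                      ≤⟨ *-monoʳ-≤ 8 four-X ⟩
    8 * (Φ + 4 * NW)                 ≡⟨ *-distribˡ-+ 8 Φ (4 * NW) ⟩
    8 * Φ + 8 * (4 * NW)             ≤⟨ +-mono-≤ small (*-monoʳ-≤ 8 (*-monoʳ-≤ 4 NW≤5kL)) ⟩
    T * L + 8 * (4 * (5 * k * L))    ≡⟨ cong (T * L +_) (collect k L) ⟩
    T * L + 160 * k * L              ≤⟨ +-monoʳ-≤ (T * L) (*-monoˡ-≤ L 160k≤T) ⟩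
    T * L + T * L                    ≡⟨ cong (T * L +_) (+-identityʳ (T * L)) ⟨
    2 * (T * L)                      ∎)
    where
    open ≤-Reasoning
    L = T ^ m
    X = subblockPotential m A
    Φ = potential (suc m) A
    NW = ∑[ t < T * L ] newThreatWeight m (A + t)
    collect : ∀ k L → 8 * (4 * (5 * k * L)) ≡ 160 * k * L
    collect = solve-∀
    X≡ : X ≡ ∑[ t < T * L ] threatWeight m (A + t)
    X≡ = sym (trans (sum-blocks T L _) (sum-cong T (λ c _ → sum-cong L (λ t _ → cong (threatWeight m) (sym (+-assoc A (c * L) t))))))
    four-X : 4 * X ≤ Φ + 4 * NW
    four-X = begin
      4 * X                                                          ≡⟨ cong (4 *_) X≡ ⟩
      4 * ∑[ t < T * L ] threatWeight m (A + t)                      ≡⟨ sum-*ˡ (T * L) 4 _ ⟨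
      ∑[ t < T * L ] (4 * threatWeight m (A + t))                    ≤⟨ sum-mono-≤ (T * L) (λ t _ → threatWeight-step m (A + t)) ⟩
      ∑[ t < T * L ] (threatWeight (suc m) (A + t) + 4 * newThreatWeight m (A + t))
                                                                     ≡⟨ sum-+ (T * L) _ _ ⟩
      Φ + ∑[ t < T * L ] (4 * newThreatWeight m (A + t))             ≡⟨ cong (Φ +_) (sum-*ˡ (T * L) 4 _) ⟩
      Φ + 4 * NW                                                     ∎
    NW≤5kL : NW ≤ 5 * k * L
    NW≤5kL = *-cancelʳ-≤ NW (5 * k * L) T (≤-trans (newThreatWeight-block m A) (≤-reflexive (regroup k L T)))
      where
      regroup : ∀ k L T → k * (5 * (T * L)) ≡ 5 * k * L * T
      regroup = solve-∀

  survivors : ℕ → ℕ → ℕ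
  survivors m A = ∑[ d < T ∸ 2 ] 𝟙[ blockLethal m A (suc d) ≟ 0 ]

  survivors+killed : ∀ m A → survivors m A + killed m A ≡ T ∸ 2
  survivors+killed m A = begin-equality
    survivors m A + killed m A                   ≡⟨ sum-+ (T ∸ 2) _ _ ⟨
    ∑[ d < T ∸ 2 ] (𝟙[ blockLethal m A (suc d) ≟ 0 ] + 𝟙[ 0 <? blockLethal m A (suc d) ])
                                                 ≡⟨ sum-cong (T ∸ 2) (λ d _ → dichotomy (blockLethal m A (suc d))) ⟩
    ∑[ _ < T ∸ 2 ] 1                             ≡⟨ sum-const (T ∸ 2) 1 ⟩
    (T ∸ 2) * 1                                  ≡⟨ *-identityʳ (T ∸ 2) ⟩
    T ∸ 2                                        ∎
    where
    open ≤-Reasoning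
    dichotomy : ∀ x → 𝟙[ x ≟ 0 ] + 𝟙[ 0 <? x ] ≡ 1
    dichotomy zero    = refl
    dichotomy (suc x) = refl

  killed-bound : ∀ m A → 8 * potential (suc m) A ≤ T ^ suc m → 8 * killed m A ≤ 3 * T
  killed-bound m A small = *-cancelʳ-≤ (8 * killed m A) (3 * T) L {{m^n≢0 T m}} (begin
    8 * killed m A * L                              ≡⟨ *-assoc 8 (killed m A) L ⟩
    8 * (killed m A * L)                            ≤⟨ *-monoʳ-≤ 8 (killed-count m A) ⟩
    8 * (3 * ∑[ t < T * L ] lethalCount m (A + t))
      ≤⟨ *-monoʳ-≤ 8 (*-monoʳ-≤ 3 (sum-mono-≤ (T * L) (λ t _ → lethalCount≤threatWeight m (A + t)))) ⟩
    8 * (3 * potential (suc m) A)                   ≡⟨ swap (potential (suc m) A) ⟩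
    3 * (8 * potential (suc m) A)                   ≤⟨ *-monoʳ-≤ 3 small ⟩
    3 * (T * L)                                     ≡⟨ *-assoc 3 T L ⟨
    3 * T * L                                       ∎)
    where
    open ≤-Reasoning
    L = T ^ m
    swap : ∀ x → 8 * (3 * x) ≡ 3 * (8 * x)
    swap = solve-∀

  survivors-bound : ∀ m A → 8 * potential (suc m) A ≤ T ^ suc m → T ≤ 2 * survivors m A
  survivors-bound m A small = *-cancelˡ-≤ 4 (+-cancelʳ-≤ (3 * T) _ _ (+-cancelʳ-≤ 16 _ _ (begin
    4 * T + 3 * T + 16                  ≡⟨ collect T ⟩
    7 * T + 16                          ≤⟨ +-monoʳ-≤ (7 * T) 16≤T ⟩
    7 * T + T                           ≡⟨ +-comm (7 * T) T ⟩
    8 * T                               ≡⟨ cong (8 *_) (m∸n+n≡m 2≤T) ⟨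
    8 * (T ∸ 2 + 2)                     ≡⟨ cong (λ x → 8 * (x + 2)) (survivors+killed m A) ⟨
    8 * (s + killed m A + 2)            ≡⟨ expand s (killed m A) ⟩
    4 * (2 * s) + 8 * killed m A + 16   ≤⟨ +-monoˡ-≤ 16 (+-monoʳ-≤ (4 * (2 * s)) (killed-bound m A small)) ⟩
    4 * (2 * s) + 3 * T + 16            ∎)))
    where
    open ≤-Reasoning
    s = survivors m A
    collect : ∀ T → 4 * T + 3 * T + 16 ≡ 7 * T + 16
    collect = solve-∀
    expand : ∀ x y → 8 * (x + y + 2) ≡ 4 * (2 * x) + 8 * y + 16
    expand = solve-∀

  survivor-clean : ∀ m A d → A + T ^ suc m ≤ J → suc d < T → Clean (suc m) A → blockLethal m A (suc d) ≡ 0 →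
                   Clean m (A + suc d * T ^ m)
  survivor-clean m A d inside d+1<T clean survives t t<L i i<k j Tᵐ≤Bʲ bad = by-scale (T ^ suc m ≤? B i ^ j)
    where
    L = T ^ m
    offset<TL : suc d * L + t < T * L
    offset<TL = <-≤-trans (+-monoʳ-< (suc d * L) t<L) (≤-trans (≤-reflexive (+-comm (suc d * L) L)) (*-monoˡ-≤ L d+1<T))
    bad′ : Bad i j (A + (suc d * L + t))
    bad′ = subst (Bad i j) (+-assoc A (suc d * L) t) bad
    j<J : j < J
    j<J = <-≤-trans (zeroDigit⇒< (B i) {{B-nonZero i}} (1<B i) j bad′) (≤-trans (<⇒≤ (+-monoʳ-< A offset<TL)) inside)
    by-scale : Dec (T ^ suc m ≤ B i ^ j) → ⊥
    by-scale (yes Tᵐ⁺¹≤Bʲ) = clean (suc d * L + t) offset<TL i i<k j Tᵐ⁺¹≤Bʲ bad′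
    by-scale (no Tᵐ⁺¹≰Bʲ)  = <-irrefl refl (≤-trans (lethalCount≥1 m _ i j i<k j<J (Tᵐ≤Bʲ , ≰⇒> Tᵐ⁺¹≰Bʲ) bad′)
                                                    (≤-reflexive (sum≡0⇒ L _ survives t t<L)))

  refine : ∀ m A → A + T ^ suc m ≤ J → Clean (suc m) A → 8 * potential (suc m) A ≤ T ^ suc m →
           ∃ λ d → suc d < T × Clean m (A + suc d * T ^ m) × 8 * potential m (A + suc d * T ^ m) ≤ T ^ m
  refine m A inside clean small =
    let (d , d<T∸2 , survives , below) = below-average (T ∸ 2) (λ d → blockLethal m A (suc d) ≟ 0) h candidates 1≤s ≤-refl
        d+1<T = <-≤-trans (s≤s d<T∸2) (≤-trans (n≤1+n _) (≤-reflexive (trans (+-comm 2 (T ∸ 2)) (m∸n+n≡m 2≤T))))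
    in  d , d+1<T , survivor-clean m A d inside d+1<T clean survives , potential-small d below
    where
    open ≤-Reasoning
    L = T ^ m
    X = subblockPotential m A
    s = survivors m A
    T≤2s : T ≤ 2 * s
    T≤2s = survivors-bound m A small
    1≤s : 1 ≤ s
    1≤s = *-cancelˡ-≤ 2 (≤-trans 2≤T T≤2s)
    h : ℕ → ℕ
    h d = potential m (A + suc d * L)
    candidates : ∑[ d < T ∸ 2 ] (𝟙[ blockLethal m A (suc d) ≟ 0 ] * h d) ≤ X
    candidates = begin
      ∑[ d < T ∸ 2 ] (𝟙[ blockLethal m A (suc d) ≟ 0 ] * h d)
        ≤⟨ sum-mono-≤ (T ∸ 2) (λ d _ → *-monoˡ-≤ (h d) (𝟙≤1 (blockLethal m A (suc d) ≟ 0))) ⟩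
      ∑[ d < T ∸ 2 ] (1 * h d)                                ≡⟨ sum-cong (T ∸ 2) (λ d _ → *-identityˡ (h d)) ⟩
      ∑[ d < T ∸ 2 ] h d
        ≤⟨ sum-shift-≤ (λ c → potential m (A + c * L)) 1 (T ∸ 2) T (≤-trans (n≤1+n _) (≤-reflexive (m+[n∸m]≡n 2≤T))) ⟩
      X                                                       ∎
    potential-small : ∀ d → h d * s ≤ X → 8 * h d ≤ L
    potential-small d below = *-cancelʳ-≤ (8 * h d) L T (begin
      8 * h d * T          ≤⟨ *-monoʳ-≤ (8 * h d) T≤2s ⟩
      8 * h d * (2 * s)    ≡⟨ regroup (h d) s ⟩
      16 * (h d * s)       ≤⟨ *-monoʳ-≤ 16 below ⟩
      16 * X               ≤⟨ subblockPotential-bound m A small ⟩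
      T * L                ≡⟨ *-comm T L ⟩
      L * T                ∎)
      where
      regroup : ∀ x y → 8 * x * (2 * y) ≡ 16 * (x * y)
      regroup = solve-∀

  block-inside : ∀ m A d → suc d < T → A + suc d * T ^ m + T ^ m ≤ A + T ^ suc m
  block-inside m A d d+1<T = ≤-trans (≤-reflexive (+-assoc A _ _))
    (+-monoʳ-≤ A (≤-trans (≤-reflexive (+-comm (suc d * T ^ m) (T ^ m))) (*-monoˡ-≤ (T ^ m) d+1<T)))

  descend : ∀ m A → A + T ^ suc m ≤ J → Clean (suc m) A → 8 * potential (suc m) A ≤ T ^ suc m →
            ∃ λ N → A + T ^ m ≤ N × Clean 0 N
  descend zero A inside clean small =
    let (d , _ , clean′ , _) = refine 0 A inside clean small
    in  A + suc d * 1 , +-monoʳ-≤ A (m≤m+n 1 (d * 1)) , clean′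
  descend (suc m) A inside clean small =
    let (d , d+1<T , clean′ , small′) = refine (suc m) A inside clean small
        A′ = A + suc d * T ^ suc m
        (N , A′+Tᵐ≤N , clean₀) = descend m A′ (≤-trans (block-inside (suc m) A d d+1<T) inside) clean′ small′
    in  N , ≤-trans (+-monoʳ-≤ A (m≤m+n (T ^ suc m) _)) (≤-trans (m≤m+n A′ (T ^ m)) A′+Tᵐ≤N) , clean₀

  clean-start : ∀ m → Clean m 0
  clean-start m t t<Tᵐ i i<k j Tᵐ≤Bʲ (Bʲ⁺¹≤t , _) =
    <-irrefl refl (<-≤-trans t<Tᵐ (≤-trans Tᵐ≤Bʲ (≤-trans (m≤n*m (B i ^ j) (B i) {{B-nonZero i}}) Bʲ⁺¹≤t)))

  threatWeight-below : ∀ m N → N < T ^ m → threatWeight m N ≡ 0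
  threatWeight-below m N N<Tᵐ =
    trans (sum-cong k (λ i _ → trans (sum-cong J (λ j _ → vanishes i j)) (sum-zero J))) (sum-zero k)
    where
    vanishes : ∀ i j → 𝟙[ threat? m i j ] * 𝟙[ bad? i j N ] * weight m (B i ^ j) ≡ 0
    vanishes i j = cong (_* weight m (B i ^ j)) (𝟙*𝟙≡0 (threat? m i j) (bad? i j N)
                     (λ threat bad → <-irrefl refl (<-≤-trans N<Tᵐ (≤-trans (proj₂ threat) (proj₁ bad)))))

  potential-start : ∀ m → potential m 0 ≡ 0
  potential-start m = trans (sum-cong (T ^ m) (threatWeight-below m)) (sum-zero (T ^ m))

  clean₀⇒noZeroDigit : ∀ N → Clean 0 N → ∀ i → i < k → ∀ j → ¬ Bad i j N
  clean₀⇒noZeroDigit N clean i i<k j bad = clean 0 z<s i i<k j (m^n>0 (B i) {{B-nonZero i}} j) (subst (Bad i j) (sym (+-identityʳ N)) bad)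

  noZeroDigit-beyond : ∀ n → T ^ suc n ≤ J → ∃ λ N → n < N × (∀ i → i < k → ∀ j → ¬ Bad i j N)
  noZeroDigit-beyond n inside =
    let (N , Tⁿ≤N , clean₀) = descend n 0 inside (clean-start (suc n)) (≤-trans (≤-reflexive (cong (8 *_) (potential-start (suc n)))) z≤n)
    in  N , <-≤-trans (n<m^n n 2≤T) Tⁿ≤N , clean₀⇒noZeroDigit N clean₀

  zeroFree-beyond : ∀ n → T ^ suc n ≤ J → ∃ λ N → n < N × (∀ i → i < k → ZeroFreeIn (B i) N)
  zeroFree-beyond n inside =
    let (N , n<N , noZero) = noZeroDigit-beyond n inside
    in  N , n<N , λ i i<k → noZeroDigit⇒ZeroFreeIn (B i) {{B-nonZero i}} (1<B i) N (<-≤-trans z<s n<N) (noZero i i<k)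

n!≤S : ∀ n → n ! ≤ S n
n!≤S zero    = ≤-refl
n!≤S (suc n) = ≤-trans (*-monoʳ-≤ (suc n) (n!≤S n)) (m≤m+n _ 1)

ELess⇒< : ∀ a c → ELess a c → c < a
ELess⇒< a c (n , n≥1 , bound) = *-cancelʳ-< (n * n !) c a (≤-<-trans (*-monoʳ-≤ c n*n!≤) bound)
  where
  n*n!≤ : n * n ! ≤ n * S n + 1
  n*n!≤ = ≤-trans (*-monoʳ-≤ n (n!≤S n)) (m≤m+n _ 1)

-- g_k(x) > 0 says x ^ (C k) < 4 ^ x with C = 4e·432²; only 3 ^ (C k) ≤ x ^ (C k) < 4 ^ x < 3 ^ (2 x) is used
GPos⇒ : ∀ k x → 3 ≤ x → GPos k x → 4 * 432 ^ 2 * k < 2 * x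
GPos⇒ k x 3≤x (p , q , q≥1 , e-bound , xᵖ<4ˣᑫ) =
  *-cancelʳ-< q _ _ (subst₂ _<_ (*-comm q (4 * 432 ^ 2 * k)) (sym (*-assoc 2 x q)) (<-trans qCk<p p<2xq))
  where
  instance _ = >-nonZero q≥1
  qCk<p : q * (4 * 432 ^ 2 * k) < p
  qCk<p = ELess⇒< p _ e-bound
  3ᵖ<3²ˣᑫ : 3 ^ p < 3 ^ (2 * (x * q))
  3ᵖ<3²ˣᑫ = begin-strict
    3 ^ p              ≤⟨ ^-monoˡ-≤ p 3≤x ⟩
    x ^ p              <⟨ xᵖ<4ˣᑫ ⟩
    4 ^ (x * q)        ≤⟨ ^-monoˡ-≤ (x * q) (m≤m+n 4 5) ⟩
    9 ^ (x * q)        ≡⟨ ^-*-assoc 3 2 (x * q) ⟩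
    3 ^ (2 * (x * q))  ∎
    where open ≤-Reasoning
  p<2xq : p < 2 * (x * q)
  p<2xq = ≰⇒> (λ 2xq≤p → <-irrefl refl (<-≤-trans 3ᵖ<3²ˣᑫ (^-monoʳ-≤ 3 2xq≤p)))

IsM⇒large : ∀ k M → 1 ≤ k → IsM k M → 16 + 160 * k ≤ M
IsM⇒large k M k≥1 (5≤M , positive , _) = ≤-trans (<⇒≤ (*-cancelˡ-< 2 _ _ (begin-strict
  2 * (16 + 160 * k)    ≡⟨ expand k ⟩
  32 + 320 * k          ≤⟨ +-monoˡ-≤ (320 * k) (m≤m*n 32 k {{>-nonZero k≥1}}) ⟩
  32 * k + 320 * k      ≡⟨ collect k ⟩
  352 * k               ≤⟨ *-monoˡ-≤ k (m≤m+n 352 746144) ⟩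
  4 * 432 ^ 2 * k       <⟨ GPos⇒ k (M ∸ 2) (∸-monoˡ-≤ 2 5≤M) positive ⟩
  2 * (M ∸ 2)           ∎))) (m∸n≤m M 2)
  where
  open ≤-Reasoning
  expand : ∀ k → 2 * (16 + 160 * k) ≡ 32 + 320 * k
  expand = solve-∀
  collect : ∀ k → 32 * k + 320 * k ≡ 352 * k
  collect = solve-∀

extend : ∀ {k} → (Fin k → ℕ) → ℕ → ℕ → ℕ
extend {k} b default n with n <? k
... | yes n<k = b (fromℕ< n<k)
... | no _    = default

extend-toℕ : ∀ {k} (b : Fin k → ℕ) default i → extend b default (toℕ i) ≡ b i
extend-toℕ {k} b default i with toℕ i <? k
... | yes i<k = cong b (fromℕ<-toℕ i i<k)
... | no i≮k  = ⊥-elim (i≮k (toℕ<n i))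

extend-≥ : ∀ {k} (b : Fin k → ℕ) {x} default → (∀ i → x ≤ b i) → x ≤ default → ∀ n → x ≤ extend b default n
extend-≥ {k} b default x≤b x≤default n with n <? k
... | yes n<k = x≤b (fromℕ< n<k)
... | no _    = x≤default

theorem1p1 : (k : ℕ) → 2 ≤ k → (M : ℕ) → IsM k M → (b : Fin k → ℕ) → (∀ i → M ≤ b i) → InfinitelyMany (λ N → ∀ i → ZeroFreeIn (b i) N)
theorem1p1 k k≥2 M isM b M≤b n =
  let (N , n<N , zeroFree) = zeroFree-beyond n ≤-refl
  in  N , n<N , λ i → subst (λ c → ZeroFreeIn c N) (extend-toℕ b M i) (zeroFree (toℕ i) (toℕ<n i))
  where
  large : 16 + 160 * k ≤ M
  large = IsM⇒large k M (≤-trans (s≤s z≤n) k≥2) isM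
  open Descent k (extend b M) M (M ^ suc n) (≤-trans (m≤m+n 16 _) large) (≤-trans (m≤n+m _ 16) large)
               (extend-≥ b M M≤b ≤-refl)
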